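{- Let $S=\{x^2+c_1,x^2+c_2\}$ for some distinct $c_1,c_2\in\mathbb{Z}$. If $S$ has a finite orbit point $P\in\mathbb{Q}$, then, up to reordering $c_1$ and $c_2$, \[(c_1,c_2)=\Big(\frac{1-y^2}{4},\frac{1-(y+2)^2}{4}\Big)\quad\text{or}\quad (c_1,c_2)=\Big(\frac{1-y^2}{4},\frac{ -3-y^2}{4}\Big)\] for some $y\in\mathbb{Z}$ with $y\equiv\pm1\pmod 4$.
   Context: Let $M_S$ be the monoid generated by $S$ under composition (including the identity). $P$ is a finite orbit point for $S$ if $\{f(P):f\in M_S\}$ is a finite set. -}

module Defs where

open import Data.Bool using (Bool; true; false)
open import Data.List using (List; []; _∷_)
open import Data.List.Membership.Propositional using (_∈_)
open import Data.Integer as ℤ using (ℤ; +_; _-_; _*_)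
open import Data.Integer.DivMod using (_%ℕ_)
open import Data.Rational as ℚ using (ℚ)
open import Data.Nat as ℕ using (ℕ)
open import Data.Product using (Σ; ∃; _×_; _,_)
open import Data.Sum using (_⊎_)
open import Relation.Binary.PropositionalEquality using (_≡_)

quadMap : ℤ → ℚ → ℚ
quadMap c x = x ℚ.* x ℚ.+ ℚ._/_ c 1

-- elements of the monoid M_S for S = {x^2+c₁, x^2+c₂}: a word over S
-- (false ↦ x^2+c₁, true ↦ x^2+c₂); the empty word is the identity and
-- the word (b ∷ w) denotes f_b ∘ [w].
evalWord : ℤ → ℤ → List Bool → ℚ → ℚ
evalWord c₁ c₂ [] x = x
evalWord c₁ c₂ (false ∷ w) x = quadMap c₁ (evalWord c₁ c₂ w x)
evalWord c₁ c₂ (true ∷ w) x = quadMap c₂ (evalWord c₁ c₂ w x)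

FiniteOrbitPoint : ℤ → ℤ → ℚ → Set
FiniteOrbitPoint c₁ c₂ P = Σ (List ℚ) λ L → ∀ (w : List Bool) → evalWord c₁ c₂ w P ∈ L

-- the conclusion for an ordered pair (a, b):
-- (a,b) = ((1-y²)/4, (1-(y+2)²)/4) or ((1-y²)/4, (-3-y²)/4), y ≡ ±1 mod 4
-- (stated by clearing the denominator 4 in ℤ)
ShapeOrdered : ℤ → ℤ → Set
ShapeOrdered a b = ∃ λ (y : ℤ) →
  ((y %ℕ 4 ≡ 1) ⊎ (y %ℕ 4 ≡ 3)) ×
  ((+ 4 * a ≡ + 1 - y * y) ×
   ((+ 4 * b ≡ + 1 - (y ℤ.+ + 2) * (y ℤ.+ + 2)) ⊎ (+ 4 * b ≡ ℤ.- + 3 - y * y)))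

-- If x = n/d with d ≥ 2, then x² + c = m/e with d² ∣ n²e, so e > d: denominators
-- strictly grow along x ↦ x² + c₁, and a finite orbit therefore contains an
-- integer. From there, moving to any point of larger absolute value reachable in
-- one or two steps must stop, at an integer v such that all these points lie in
-- [-M, M], M = |v|. For a = M² + c, the bounds |a| ≤ M and a² + c ≥ -M give
-- (a - M + 1)(a + M) ≥ 0, so a ∈ {M, M - 1, -M}. Two distinct values {M, -M} or
-- {M, M - 1} give the two families with y = 2M - 1; the pair {M - 1, -M} is
-- impossible because then (M - 1)² + c₂ = 1 - 3M < -M.

module Submission where

open import Defs
open import Data.Integer using (ℤ)
open import Data.Rational using (ℚ)
open import Data.Sum using (_⊎_)
open import Relation.Binary.PropositionalEquality using (_≢_)

open import Data.Bool using (Bool; true; false)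
open import Data.Integer as ℤ using (+_; -[1+_]; 0ℤ; 1ℤ; _+_; _-_; _*_; -_; ∣_∣; _≤_; _<_)
open import Data.Integer.DivMod using (_%ℕ_)
import Data.Integer.Properties as ℤ
open import Data.Integer.Tactic.RingSolver using (solve-∀)
open import Data.List using (List; []; _∷_; _++_)
open import Data.List.Extrema.Nat using (argmax; f[xs]≤f[argmax])
open import Data.List.Relation.Unary.All as All using (All; []; _∷_; all?)
open import Data.List.Relation.Unary.All.Properties using (¬All⇒Any¬)
import Data.List.Relation.Unary.Any as Any
open import Data.Nat as ℕ using (ℕ; zero; suc; NonZero)
open import Data.Nat.Coprimality as Coprime using (Coprime; coprime-divisor; 1-coprimeTo)
open import Data.Nat.Divisibility using (_∣_; divides; ∣-trans; ∣-refl; m∣m*n; ∣⇒≤; *-cancelʳ-∣)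
open import Data.Nat.DivMod using ([m+n]%n≡m%n)
import Data.Nat.Induction as ℕ
import Data.Nat.Properties as ℕ
open import Data.Nat.Tactic.RingSolver using () renaming (solve-∀ to ℕ-solve-∀)
open import Data.Product using (∃-syntax; _×_; _,_; proj₁; proj₂; map₂)
open import Data.Rational as ℚ using (mkℚ; _/_; ↥_; ↧_; ↧ₙ_; toℚᵘ)
import Data.Rational.Properties as ℚ
open import Data.Rational.Unnormalised as ℚᵘ using (mkℚᵘ; *≡*)
import Data.Rational.Unnormalised.Properties as ℚᵘ
open import Data.Sum using (inj₁; inj₂)
open import Function using (_∘_)
open import Induction.WellFounded using (Acc; acc)
open import Relation.Binary.PropositionalEquality
open import Relation.Nullary using (¬_; Dec; yes; no; contradiction)

coprime∧d*d∣n*n*e⇒d<e : ∀ {n d e} .{{_ : NonZero e}} → 2 ℕ.≤ d → Coprime n d →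
                        d ℕ.* d ∣ n ℕ.* n ℕ.* e → d ℕ.< e
coprime∧d*d∣n*n*e⇒d<e {n} {d} {e} 2≤d n⊥d dd∣nne = ℕ.≤∧≢⇒< (∣⇒≤ d∣e) d≢e
  where
  instance _ = ℕ.>-nonZero (ℕ.≤-trans (ℕ.s≤s ℕ.z≤n) 2≤d)
  d⊥n : Coprime d n
  d⊥n = Coprime.sym n⊥d
  d∣e : d ∣ e
  d∣e = coprime-divisor d⊥n (coprime-divisor d⊥n
          (subst (d ∣_) (ℕ.*-assoc n n e) (∣-trans (m∣m*n d) dd∣nne)))
  d≢e : d ≢ e
  d≢e refl = ℕ.<⇒≢ 2≤d (sym (n⊥d (coprime-divisor d⊥n (*-cancelʳ-∣ d dd∣nne) , ∣-refl)))

∣i∣≤n⇒-n≤i≤n : ∀ {i n} → ∣ i ∣ ℕ.≤ n → - + n ≤ i × i ≤ + n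
∣i∣≤n⇒-n≤i≤n {+ _}      ∣i∣≤n            = ℤ.neg-≤-pos , ℤ.+≤+ ∣i∣≤n
∣i∣≤n⇒-n≤i≤n { -[1+ _ ]} (ℕ.s≤s ∣i∣-1≤n) = ℤ.-≤- ∣i∣-1≤n , ℤ.-≤+

i*i≡∣i∣*∣i∣ : ∀ i → i * i ≡ + ∣ i ∣ * + ∣ i ∣
i*i≡∣i∣*∣i∣ (+ _)      = refl
i*i≡∣i∣*∣i∣ -[1+ _ ]   = refl

endpoint-cases : ∀ m a → - m ≤ a → a ≤ m → 0ℤ ≤ (a - (m - 1ℤ)) * (a + m) →
                 a ≡ m ⊎ a ≡ m - 1ℤ ⊎ a ≡ - m
endpoint-cases m a -m≤a a≤m 0≤product with a ℤ.≟ - m | a ℤ.≟ m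
... | yes a≡-m | _       = inj₂ (inj₂ a≡-m)
... | no  _    | yes a≡m = inj₁ a≡m
... | no  a≢-m | no  a≢m = inj₂ (inj₁ (ℤ.≤-antisym a≤m-1 m-1≤a))
  where
  0<a+m : 0ℤ < a + m
  0<a+m = subst (_< a + m) (ℤ.+-inverseˡ m) (ℤ.+-monoˡ-< m (ℤ.≤∧≢⇒< -m≤a (a≢-m ∘ sym)))
  m-1≤a : m - 1ℤ ≤ a
  m-1≤a = ℤ.0≤i-j⇒j≤i (ℤ.*-cancelʳ-≤-pos 0ℤ (a - (m - 1ℤ)) (a + m) {{ℤ.positive 0<a+m}} 0≤product)
  a≤m-1 : a ≤ m - 1ℤ
  a≤m-1 = subst (a ≤_) (ℤ.+-comm ℤ.-1ℤ m) (ℤ.i<j⇒i≤pred[j] (ℤ.≤∧≢⇒< a≤m a≢m))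

[1+2n]%4≡1∨3 : ∀ n → (1 ℕ.+ 2 ℕ.* n) ℕ.% 4 ≡ 1 ⊎ (1 ℕ.+ 2 ℕ.* n) ℕ.% 4 ≡ 3
[1+2n]%4≡1∨3 zero          = inj₁ refl
[1+2n]%4≡1∨3 (suc zero)    = inj₂ refl
[1+2n]%4≡1∨3 (suc (suc n)) = subst (λ r → r ≡ 1 ⊎ r ≡ 3) (sym (begin
  (1 ℕ.+ 2 ℕ.* (2 ℕ.+ n)) ℕ.% 4 ≡⟨ cong (ℕ._% 4) (regroup n) ⟩
  (1 ℕ.+ 2 ℕ.* n ℕ.+ 4) ℕ.% 4   ≡⟨ [m+n]%n≡m%n (1 ℕ.+ 2 ℕ.* n) 4 ⟩
  (1 ℕ.+ 2 ℕ.* n) ℕ.% 4         ∎)) ([1+2n]%4≡1∨3 n)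
  where
  open ≡-Reasoning
  regroup : ∀ n → 1 ℕ.+ 2 ℕ.* (2 ℕ.+ n) ≡ 1 ℕ.+ 2 ℕ.* n ℕ.+ 4
  regroup = ℕ-solve-∀

[2m-1]%ℕ4≡1∨3 : ∀ M → (+ 2 * + M - 1ℤ) %ℕ 4 ≡ 1 ⊎ (+ 2 * + M - 1ℤ) %ℕ 4 ≡ 3
[2m-1]%ℕ4≡1∨3 zero    = inj₂ refl
[2m-1]%ℕ4≡1∨3 (suc k) = subst (λ y → y %ℕ 4 ≡ 1 ⊎ y %ℕ 4 ≡ 3) (sym (begin
  + 2 * (1ℤ + + k) - 1ℤ ≡⟨ regroup (+ k) ⟩
  1ℤ + + 2 * + k        ≡⟨ cong (λ z → 1ℤ + z) (ℤ.pos-* 2 k) ⟨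
  + (1 ℕ.+ 2 ℕ.* k)     ∎)) ([1+2n]%4≡1∨3 k)
  where
  open ≡-Reasoning
  regroup : ∀ K → + 2 * (1ℤ + K) - 1ℤ ≡ 1ℤ + + 2 * K
  regroup = solve-∀

module _ {A : Set} (μ : A → ℕ) (B : ℕ) {R G : A → Set}
         (bounded : ∀ {x} → R x → μ x ℕ.≤ B)
         (progress : ∀ {x} → R x → G x ⊎ ∃[ y ] R y × μ x ℕ.< μ y) where

  bounded-ascent : ∀ {x} → R x → ∃[ y ] R y × G y
  bounded-ascent r = go r (ℕ.<-wellFounded (B ℕ.∸ μ _))
    where
    go : ∀ {x} → R x → Acc ℕ._<_ (B ℕ.∸ μ x) → ∃[ y ] R y × G y
    go {x} r (acc rs) with progress r
    ... | inj₁ g              = x , r , g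
    ... | inj₂ (y , r′ , x<y) = go r′ (rs (ℕ.∸-monoʳ-< x<y (bounded r′)))

ι : ℤ → ℚ
ι v = v / 1

coprime-1 : ∀ n → Coprime n 1
coprime-1 n = Coprime.sym (1-coprimeTo n)

ι-mkℚ : ∀ v → ι v ≡ mkℚ v 0 (coprime-1 ∣ v ∣)
ι-mkℚ v = ℚ.↥p/↧p≡p (mkℚ v 0 _)

↥-ι : ∀ v → ↥ ι v ≡ v
↥-ι v = cong ↥_ (ι-mkℚ v)

ι-↥ : ∀ x → ↧ₙ x ≡ 1 → ι (↥ x) ≡ x
ι-↥ (mkℚ n zero _) refl = ℚ.↥p/↧p≡p (mkℚ n 0 _)

quadMapℤ : ℤ → ℤ → ℤ
quadMapℤ c v = v * v + c

quadMap-ι : ∀ c v → quadMap c (ι v) ≡ ι (quadMapℤ c v)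
quadMap-ι c v = begin
  ι v ℚ.* ι v ℚ.+ ι c     ≡⟨ cong₂ (λ p q → p ℚ.* p ℚ.+ q) (ι-mkℚ v) (ι-mkℚ c) ⟩
  ι (v * v) ℚ.+ c/1       ≡⟨ cong (ℚ._+ c/1) (ι-mkℚ (v * v)) ⟩
  ι (v * v * 1ℤ + c * 1ℤ) ≡⟨ cong ι (cong₂ _+_ (ℤ.*-identityʳ (v * v)) (ℤ.*-identityʳ c)) ⟩
  ι (v * v + c)           ∎
  where
  open ≡-Reasoning
  c/1 = mkℚ c 0 (coprime-1 ∣ c ∣)

toℚᵘ-quadMap : ∀ c x → toℚᵘ (quadMap c x) ℚᵘ.≃ toℚᵘ x ℚᵘ.* toℚᵘ x ℚᵘ.+ mkℚᵘ c 0
toℚᵘ-quadMap c x = ℚᵘ.≃-trans (ℚ.toℚᵘ-homo-+ (x ℚ.* x) (ι c))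
  (ℚᵘ.+-cong (ℚ.toℚᵘ-homo-* x x) (ℚᵘ.≃-reflexive (cong toℚᵘ (ι-mkℚ c))))

quadMap-cross : ∀ c x → let y = quadMap c x in
  ↥ x * ↥ x * ↧ y ≡ (↥ y - c * ↧ y) * + (↧ₙ x ℕ.* ↧ₙ x)
quadMap-cross c x@record{} with toℚᵘ-quadMap c x
... | *≡* cross = begin
  n * n * e                            ≡⟨ expand (n * n) e c D ⟩
  (n * n * 1ℤ + c * D) * e - c * e * D ≡⟨ cong (_- c * e * D) lhs-cross ⟨
  m * D - c * e * D                    ≡⟨ factor m e c D ⟩
  (m - c * e) * D                      ∎
  where
  open ≡-Reasoning
  y = quadMap c x
  n = ↥ x
  m = ↥ y
  e = ↧ y
  D = + (↧ₙ x ℕ.* ↧ₙ x)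
  lhs-cross : m * D ≡ (n * n * 1ℤ + c * D) * e
  lhs-cross = begin
    m * D                                 ≡⟨ cong (λ k → m * + k) (ℕ.*-identityʳ (↧ₙ x ℕ.* ↧ₙ x)) ⟨
    m * + (↧ₙ x ℕ.* ↧ₙ x ℕ.* 1)           ≡⟨ cong (_* + (↧ₙ x ℕ.* ↧ₙ x ℕ.* 1)) (ℚ.↥ᵘ-toℚᵘ y) ⟨
    ℚᵘ.↥ toℚᵘ y * + (↧ₙ x ℕ.* ↧ₙ x ℕ.* 1) ≡⟨ cross ⟩
    (n * n * 1ℤ + c * D) * ℚᵘ.↧ toℚᵘ y    ≡⟨ cong ((n * n * 1ℤ + c * D) *_) (ℚ.↧ᵘ-toℚᵘ y) ⟩
    (n * n * 1ℤ + c * D) * e              ∎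
  expand : ∀ nn e c D → nn * e ≡ (nn * 1ℤ + c * D) * e - c * e * D
  expand = solve-∀
  factor : ∀ m e c D → m * D - c * e * D ≡ (m - c * e) * D
  factor = solve-∀

↧ₙ-quadMap : ∀ c x → 2 ℕ.≤ ↧ₙ x → ↧ₙ x ℕ.< ↧ₙ quadMap c x
↧ₙ-quadMap c x@(mkℚ _ _ n⊥d) 2≤d = coprime∧d*d∣n*n*e⇒d<e 2≤d (Coprime.recompute n⊥d)
  (divides ∣ ↥ y - c * ↧ y ∣ (begin
    ∣ ↥ x ∣ ℕ.* ∣ ↥ x ∣ ℕ.* ↧ₙ y             ≡⟨ cong (ℕ._* ↧ₙ y) (ℤ.abs-* (↥ x) (↥ x)) ⟨
    ∣ ↥ x * ↥ x ∣ ℕ.* ↧ₙ y                  ≡⟨ ℤ.abs-* (↥ x * ↥ x) (↧ y) ⟨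
    ∣ ↥ x * ↥ x * ↧ y ∣                     ≡⟨ cong ∣_∣ (quadMap-cross c x) ⟩
    ∣ (↥ y - c * ↧ y) * + (↧ₙ x ℕ.* ↧ₙ x) ∣ ≡⟨ ℤ.abs-* (↥ y - c * ↧ y) _ ⟩
    ∣ ↥ y - c * ↧ y ∣ ℕ.* (↧ₙ x ℕ.* ↧ₙ x)   ∎))
  where
  open ≡-Reasoning
  y = quadMap c x

evalℤ : ℤ → ℤ → List Bool → ℤ → ℤ
evalℤ c₁ c₂ []          v = v
evalℤ c₁ c₂ (false ∷ w) v = quadMapℤ c₁ (evalℤ c₁ c₂ w v)
evalℤ c₁ c₂ (true ∷ w)  v = quadMapℤ c₂ (evalℤ c₁ c₂ w v)

evalWord-ι : ∀ c₁ c₂ w v → evalWord c₁ c₂ w (ι v) ≡ ι (evalℤ c₁ c₂ w v)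
evalWord-ι c₁ c₂ []          v = refl
evalWord-ι c₁ c₂ (false ∷ w) v =
  trans (cong (quadMap c₁) (evalWord-ι c₁ c₂ w v)) (quadMap-ι c₁ (evalℤ c₁ c₂ w v))
evalWord-ι c₁ c₂ (true ∷ w)  v =
  trans (cong (quadMap c₂) (evalWord-ι c₁ c₂ w v)) (quadMap-ι c₂ (evalℤ c₁ c₂ w v))

evalWord-++ : ∀ c₁ c₂ u w x → evalWord c₁ c₂ (u ++ w) x ≡ evalWord c₁ c₂ u (evalWord c₁ c₂ w x)
evalWord-++ c₁ c₂ []          w x = refl
evalWord-++ c₁ c₂ (false ∷ u) w x = cong (quadMap c₁) (evalWord-++ c₁ c₂ u w x)
evalWord-++ c₁ c₂ (true ∷ u)  w x = cong (quadMap c₂) (evalWord-++ c₁ c₂ u w x)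

shortWords : List (List Bool)
shortWords = (false ∷ []) ∷ (true ∷ []) ∷
             (false ∷ false ∷ []) ∷ (false ∷ true ∷ []) ∷ (true ∷ false ∷ []) ∷ (true ∷ true ∷ []) ∷ []

Settled : ℤ → ℤ → ℤ → Set
Settled c₁ c₂ v = All (λ w → ∣ evalℤ c₁ c₂ w v ∣ ℕ.≤ ∣ v ∣) shortWords

module FiniteOrbit {c₁ c₂ : ℤ} {P : ℚ} (finite : FiniteOrbitPoint c₁ c₂ P) where

  InOrbit : ℚ → Set
  InOrbit x = ∃[ w ] evalWord c₁ c₂ w P ≡ x

  orbit-closed : ∀ u {x} → InOrbit x → InOrbit (evalWord c₁ c₂ u x)
  orbit-closed u (w , refl) = u ++ w , evalWord-++ c₁ c₂ u w P

  bound : (ℚ → ℕ) → ℕ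
  bound f = f (argmax f P (proj₁ finite))

  ≤-bound : ∀ f {x} → InOrbit x → f x ℕ.≤ bound f
  ≤-bound f (w , refl) = All.lookup (f[xs]≤f[argmax] {f = f} P (proj₁ finite)) (proj₂ finite w)

  integral-or-denominator-grows : ∀ {x} → InOrbit x → ↧ₙ x ≡ 1 ⊎ ∃[ y ] InOrbit y × ↧ₙ x ℕ.< ↧ₙ y
  integral-or-denominator-grows {x} o with ↧ₙ x ℕ.≟ 1
  ... | yes ↧x≡1 = inj₁ ↧x≡1
  ... | no  ↧x≢1 = inj₂ (quadMap c₁ x , orbit-closed (false ∷ []) o ,
                         ↧ₙ-quadMap c₁ x (ℕ.≤∧≢⇒< (ℕ.s≤s ℕ.z≤n) (↧x≢1 ∘ sym)))

  integral-point : ∃[ v ] InOrbit (ι v)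
  integral-point
    with bounded-ascent ↧ₙ_ (bound ↧ₙ_) (≤-bound ↧ₙ_) integral-or-denominator-grows ([] , refl)
  ... | x , o , ↧x≡1 = ↥ x , subst InOrbit (sym (ι-↥ x ↧x≡1)) o

  integral-bounded : ∀ {v} → InOrbit (ι v) → ∣ v ∣ ℕ.≤ bound (∣_∣ ∘ ↥_)
  integral-bounded {v} o = subst (λ u → ∣ u ∣ ℕ.≤ bound (∣_∣ ∘ ↥_)) (↥-ι v) (≤-bound (∣_∣ ∘ ↥_) o)

  fits? : ∀ v w → Dec (∣ evalℤ c₁ c₂ w v ∣ ℕ.≤ ∣ v ∣)
  fits? v w = ∣ evalℤ c₁ c₂ w v ∣ ℕ.≤? ∣ v ∣

  settled-or-escapes : ∀ {v} → InOrbit (ι v) → Settled c₁ c₂ v ⊎ ∃[ u ] InOrbit (ι u) × ∣ v ∣ ℕ.< ∣ u ∣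
  settled-or-escapes {v} o with all? (fits? v) shortWords
  ... | yes settled = inj₁ settled
  ... | no ¬settled with Any.satisfied (¬All⇒Any¬ (fits? v) shortWords ¬settled)
  ...   | w , escapes = inj₂ (evalℤ c₁ c₂ w v ,
                              subst InOrbit (evalWord-ι c₁ c₂ w v) (orbit-closed w o) , ℕ.≰⇒> escapes)

  settled-point : ∃[ v ] Settled c₁ c₂ v
  settled-point with integral-point
  ... | v , o = map₂ proj₂ (bounded-ascent ∣_∣ (bound (∣_∣ ∘ ↥_)) {R = InOrbit ∘ ι}
                              (λ {u} → integral-bounded {u}) (λ {u} → settled-or-escapes {u}) {v} o)

-- A constructor's name records the value of M² + c; ↦M-1 needs M ≥ 1, since for
-- M = 0 it would give M² + c = -1 < -M.
data BoundedShift : ℕ → ℤ → Set where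
  ↦M   : ∀ {M} → BoundedShift M (+ M - + M * + M)
  ↦M-1 : ∀ {k} → BoundedShift (suc k) (+ suc k - 1ℤ - + suc k * + suc k)
  ↦-M  : ∀ {M} → BoundedShift M (- + M - + M * + M)

m*m+c≡t⇒c≡t-m*m : ∀ m {c t} → m * m + c ≡ t → c ≡ t - m * m
m*m+c≡t⇒c≡t-m*m m {c} eq = trans (cancel m c) (cong (_- m * m) eq)
  where
  cancel : ∀ m c → c ≡ m * m + c - m * m
  cancel = solve-∀

boundedShift-M-1 : ∀ M c → - + M ≤ + M * + M + c → + M * + M + c ≡ + M - 1ℤ → BoundedShift M c
boundedShift-M-1 zero    c -0≤a a≡-1 with () ← subst (- + 0 ≤_) a≡-1 -0≤a
boundedShift-M-1 (suc k) c _    a≡M-1 =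
  subst (BoundedShift (suc k)) (sym (m*m+c≡t⇒c≡t-m*m (+ suc k) a≡M-1)) ↦M-1

boundedShift : ∀ M c → let a = + M * + M + c in
               ∣ a ∣ ℕ.≤ M → ∣ a * a + c ∣ ℕ.≤ M → BoundedShift M c
boundedShift M c ∣a∣≤M ∣a²+c∣≤M = from-endpoint (endpoint-cases m a -m≤a a≤m 0≤product)
  where
  m = + M
  a = m * m + c
  -m≤a : - m ≤ a
  -m≤a = proj₁ (∣i∣≤n⇒-n≤i≤n ∣a∣≤M)
  a≤m : a ≤ m
  a≤m = proj₂ (∣i∣≤n⇒-n≤i≤n ∣a∣≤M)
  factorise : ∀ m c → let a = m * m + c in a * a + c - - m ≡ (a - (m - 1ℤ)) * (a + m)
  factorise = solve-∀
  0≤product : 0ℤ ≤ (a - (m - 1ℤ)) * (a + m)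
  0≤product = subst (0ℤ ≤_) (factorise m c)
                (ℤ.i≤j⇒0≤j-i (proj₁ (∣i∣≤n⇒-n≤i≤n {a * a + c} ∣a²+c∣≤M)))
  from-endpoint : a ≡ m ⊎ a ≡ m - 1ℤ ⊎ a ≡ - m → BoundedShift M c
  from-endpoint (inj₁ a≡M)          = subst (BoundedShift M) (sym (m*m+c≡t⇒c≡t-m*m m a≡M)) ↦M
  from-endpoint (inj₂ (inj₁ a≡M-1)) = boundedShift-M-1 M c -m≤a a≡M-1
  from-endpoint (inj₂ (inj₂ a≡-M))  = subst (BoundedShift M) (sym (m*m+c≡t⇒c≡t-m*m m a≡-M)) ↦-M

¬↦M-1∧↦-M : ∀ k → let m = + suc k; c₁ = m - 1ℤ - m * m; c₂ = - m - m * m in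
            ¬ (- m ≤ (m * m + c₁) * (m * m + c₁) + c₂)
¬↦M-1∧↦-M k -m≤a₁²+c₂ = 0≰-[1+2k] (subst (λ z → 0ℤ ≤ - (1ℤ + z)) (sym (ℤ.pos-* 2 k))
                             (subst (0ℤ ≤_) (margin (+ k)) (ℤ.i≤j⇒0≤j-i -m≤a₁²+c₂)))
  where
  0≰-[1+2k] : ¬ (0ℤ ≤ -[1+ 2 ℕ.* k ])
  0≰-[1+2k] ()
  margin : ∀ K → let m = 1ℤ + K; a₁ = m * m + (m - 1ℤ - m * m) in
           a₁ * a₁ + (- m - m * m) - - m ≡ - (1ℤ + + 2 * K)
  margin = solve-∀

shape-↦M-↦-M : ∀ M → ShapeOrdered (+ M - + M * + M) (- + M - + M * + M)
shape-↦M-↦-M M = + 2 * + M - 1ℤ , [2m-1]%ℕ4≡1∨3 M , first (+ M) , inj₁ (second (+ M))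
  where
  first : ∀ m → + 4 * (m - m * m) ≡ 1ℤ - (+ 2 * m - 1ℤ) * (+ 2 * m - 1ℤ)
  first = solve-∀
  second : ∀ m → + 4 * (- m - m * m) ≡ 1ℤ - (+ 2 * m - 1ℤ + + 2) * (+ 2 * m - 1ℤ + + 2)
  second = solve-∀

shape-↦M-↦M-1 : ∀ M → ShapeOrdered (+ M - + M * + M) (+ M - 1ℤ - + M * + M)
shape-↦M-↦M-1 M = + 2 * + M - 1ℤ , [2m-1]%ℕ4≡1∨3 M , first (+ M) , inj₂ (second (+ M))
  where
  first : ∀ m → + 4 * (m - m * m) ≡ 1ℤ - (+ 2 * m - 1ℤ) * (+ 2 * m - 1ℤ)
  first = solve-∀
  second : ∀ m → + 4 * (m - 1ℤ - m * m) ≡ - + 3 - (+ 2 * m - 1ℤ) * (+ 2 * m - 1ℤ)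
  second = solve-∀

classify : ∀ {M c₁ c₂} → c₁ ≢ c₂ → BoundedShift M c₁ → BoundedShift M c₂ →
           let m = + M; a₁ = m * m + c₁; a₂ = m * m + c₂ in
           - m ≤ a₁ * a₁ + c₂ → - m ≤ a₂ * a₂ + c₁ → ShapeOrdered c₁ c₂ ⊎ ShapeOrdered c₂ c₁
classify         c₁≢c₂ ↦M   ↦M   _ _ = contradiction refl c₁≢c₂
classify {M}     _     ↦M   ↦M-1 _ _ = inj₁ (shape-↦M-↦M-1 M)
classify {M}     _     ↦M   ↦-M  _ _ = inj₁ (shape-↦M-↦-M M)
classify {M}     _     ↦M-1 ↦M   _ _ = inj₂ (shape-↦M-↦M-1 M)
classify         c₁≢c₂ ↦M-1 ↦M-1 _ _ = contradiction refl c₁≢c₂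
classify {suc k} _     ↦M-1 ↦-M  h _ = contradiction h (¬↦M-1∧↦-M k)
classify {M}     _     ↦-M  ↦M   _ _ = inj₂ (shape-↦M-↦-M M)
classify {suc k} _     ↦-M  ↦M-1 _ h = contradiction h (¬↦M-1∧↦-M k)
classify         c₁≢c₂ ↦-M  ↦-M  _ _ = contradiction refl c₁≢c₂

settled⇒shape : ∀ {c₁ c₂} v → c₁ ≢ c₂ → Settled c₁ c₂ v → ShapeOrdered c₁ c₂ ⊎ ShapeOrdered c₂ c₁
-- hᵢⱼ bounds (v² + cᵢ)² + cⱼ: a word acts from right to left.
settled⇒shape {c₁} {c₂} v c₁≢c₂ (h₁ ∷ h₂ ∷ h₁₁ ∷ h₂₁ ∷ h₁₂ ∷ h₂₂ ∷ []) rewrite i*i≡∣i∣*∣i∣ v =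
  classify c₁≢c₂ (boundedShift ∣ v ∣ c₁ h₁ h₁₁) (boundedShift ∣ v ∣ c₂ h₂ h₂₂)
    (proj₁ (∣i∣≤n⇒-n≤i≤n h₁₂)) (proj₁ (∣i∣≤n⇒-n≤i≤n h₂₁))

lemma3p6 : (c₁ c₂ : ℤ) → c₁ ≢ c₂ → (P : ℚ) → FiniteOrbitPoint c₁ c₂ P →
    ShapeOrdered c₁ c₂ ⊎ ShapeOrdered c₂ c₁
lemma3p6 c₁ c₂ c₁≢c₂ P finite =
  let v , settled = FiniteOrbit.settled-point finite in settled⇒shape v c₁≢c₂ settled
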